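{- In the Chung-Lu random graph model, let $s\neq t$ be nodes and $r\ge 1$ an integer. Then $$p_{st}\left(\frac{S_2}{S}\right)^{r-1}\left(1-\frac{r(r+1)p_{max}}{2}\frac{S}{S_2}\right) \leq E[SP_{r}(s,t)],$$ where $p_{st}$ is the probability that an edge exists connecting $s$ and $t$.
   Context: Chung-Lu random graph model: $n$ nodes with expected degrees $d_1,\dots,d_n$, $S=\sum_i d_i$, $\max_i d_i^2\le S$; each undirected edge $\{i,j\}$ (self-loops allowed) is present independently with probability $p_{ij}=d_id_j/S$. $S_2=\sum_i d_i^2$, $d_{max}=\max_i d_i$, $p_{max}=d_{max}^2/S$. $SP_r(s,t)$ is the number of simple paths of length $r$ from $s$ to $t$, i.e. sequences of distinct nodes $(x_0,\dots,x_r)$ with $x_0=s$, $x_r=t$ and each $\{x_i,x_{i+1}\}$ an edge.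
   Formalization: The expected degrees $d_1,\dots,d_n$ are rational. -}

module Defs where

open import Data.Bool using (Bool; true; false; _∧_; _∨_; not; if_then_else_)
open import Data.Nat as ℕ using (ℕ; zero; suc; _≤ᵇ_)
open import Data.Fin using (Fin; toℕ)
open import Data.Fin.Properties using () renaming (_≟_ to _≟F_)
open import Data.Integer using (+_)
open import Data.List using (List; []; _∷_; map; concatMap; foldr; allFin)
open import Data.Bool.ListAction using (any)
open import Data.Product using (_×_; _,_; proj₁; proj₂)
open import Data.Rational using (ℚ; 0ℚ; 1ℚ; _+_; _*_; _-_; _÷_; _⊔_; _/_; ≢-nonZero)
open import Data.Rational.Properties using (_≟_)
open import Relation.Nullary using (yes; no)
open import Relation.Nullary.Decidable using (⌊_⌋)

ℕ→ℚ : ℕ → ℚ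
ℕ→ℚ k = (+ k) / 1

-- total division (x / 0 := 0); only ever used with nonzero denominators below
_÷'_ : ℚ → ℚ → ℚ
p ÷' q with q ≟ 0ℚ
... | yes _ = 0ℚ
... | no q≢0 = _÷_ p q {{≢-nonZero q≢0}}

_^'_ : ℚ → ℕ → ℚ
p ^' zero = 1ℚ
p ^' suc k = p * (p ^' k)

sumℚ : List ℚ → ℚ
sumℚ = foldr _+_ 0ℚ

module ChungLu {n : ℕ} (d : Fin n → ℚ) where

  S : ℚ
  S = sumℚ (map d (allFin n))

  S₂ : ℚ
  S₂ = sumℚ (map (λ i → d i * d i) (allFin n))

  dmax : ℚ
  dmax = foldr _⊔_ 0ℚ (map d (allFin n))   -- degrees are ≥ 0, so this is max_i d_i

  pmax : ℚ
  pmax = (dmax * dmax) ÷' S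

  p : Fin n → Fin n → ℚ
  p i j = (d i * d j) ÷' S

  -- the undirected edges {i,j} (self-loops allowed), each listed once as (i,j) with i ≤ j
  Edges : List (Fin n × Fin n)
  Edges = concatMap (λ i → concatMap (λ j → if toℕ i ≤ᵇ toℕ j then (i , j) ∷ [] else []) (allFin n)) (allFin n)

  -- the finite probability space: all outcomes (set of present edges, probability of that outcome),
  -- each edge present independently with probability p_ij
  outcomes : List (Fin n × Fin n) → List (List (Fin n × Fin n) × ℚ)
  outcomes [] = ([] , 1ℚ) ∷ []
  outcomes ((i , j) ∷ es) =
    concatMap (λ w → (((i , j) ∷ proj₁ w) , p i j * proj₂ w) ∷ (proj₁ w , (1ℚ - p i j) * proj₂ w) ∷ [])
              (outcomes es)

  Graph : Set
  Graph = List (Fin n × Fin n)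

  _==_ : Fin n → Fin n → Bool
  x == y = ⌊ x ≟F y ⌋

  adj : Graph → Fin n → Fin n → Bool
  adj G x y = any (λ e → ((proj₁ e == x) ∧ (proj₂ e == y)) ∨ ((proj₁ e == y) ∧ (proj₂ e == x))) G

  seqs : ℕ → List (List (Fin n))
  seqs zero = [] ∷ []
  seqs (suc k) = concatMap (λ x → map (x ∷_) (seqs k)) (allFin n)

  notIn : Fin n → List (Fin n) → Bool
  notIn x xs = not (any (x ==_) xs)

  distinct : List (Fin n) → Bool
  distinct [] = true
  distinct (x ∷ xs) = notIn x xs ∧ distinct xs

  walkTo : Graph → Fin n → List (Fin n) → Bool
  walkTo G t [] = false
  walkTo G t (x ∷ []) = x == t
  walkTo G t (x ∷ y ∷ xs) = adj G x y ∧ walkTo G t (y ∷ xs)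

  isSimplePath : Graph → Fin n → Fin n → List (Fin n) → Bool
  isSimplePath G s t [] = false
  isSimplePath G s t (x ∷ xs) = (x == s) ∧ distinct (x ∷ xs) ∧ walkTo G t (x ∷ xs)

  count : {A : Set} → (A → Bool) → List A → ℕ
  count P [] = zero
  count P (a ∷ as) = if P a then suc (count P as) else count P as

  SP : Graph → ℕ → Fin n → Fin n → ℕ
  SP G r s t = count (isSimplePath G s t) (seqs (suc r))

  ESP : ℕ → Fin n → Fin n → ℚ
  ESP r s t = sumℚ (map (λ w → proj₂ w * ℕ→ℚ (SP (proj₁ w) r s t)) (outcomes Edges))

{-# OPTIONS --safe #-}

-- Since edges are independent, E[SP_r(s,t)] is the sum over simple paths s = x₀, …, x_r = t of
-- ∏ p_{x_i x_{i+1}}. Let J_k(a, F) be this sum over the simple paths of length k from a to t that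
-- avoid a vertex set F. Then J_{k+1}(a, F) = Σ_b p_ab J_k(b, F ∪ {a}), and p_ab p_bt = p_at d_b²/S.
-- Excluding the |F| + 2 forbidden vertices b removes at most (|F| + 2) d_max² from S₂ = Σ_b d_b².
-- So induction on k gives
--   S₂ J_{m+1}(a, F) ≥ p_at (S₂/S)^m (S₂ − c d_max²),   c = Σ_{i<m} (|F| + 2 + i).
-- For F = ∅ and r = m + 1 we have c + 1 = r(r+1)/2, so dividing by S₂ gives the (weaker) stated bound.
module Submission where

open import Defs
open import Data.Nat using (ℕ; _≥_)
open import Data.Fin using (Fin)
open import Data.Rational using (ℚ; 0ℚ; 1ℚ; _≤_; _<_; _*_; _-_)
open import Relation.Binary.PropositionalEquality using (_≢_)

open import Data.Bool using (Bool; true; false; _∧_; _∨_; not; if_then_else_)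
open import Data.Bool.ListAction using (any; all)
import Data.Bool.Properties as 𝔹
open import Data.Empty using (⊥; ⊥-elim)
open import Data.Fin as F using (toℕ)
import Data.Fin.Properties as Fₚ
import Data.Integer as ℤ
import Data.Integer.Properties as ℤₚ
import Data.Integer.Tactic.RingSolver as ℤ-Solver
open import Data.List using (List; []; _∷_; _++_; map; concatMap; foldr; allFin; length)
import Data.List.Properties as Listₚ
open import Data.List.Membership.Propositional using (_∈_)
open import Data.List.Membership.Propositional.Properties using (∈-allFin; ∈-map⁺)
open import Data.List.Relation.Binary.Sublist.Propositional using (_⊆_; []; _∷_; _∷ʳ_)
open import Data.List.Relation.Unary.All as All using (All; []; _∷_)
open import Data.List.Relation.Unary.Any as Any using (Any; here; there)
open import Data.Nat as ℕ using (zero; suc)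
import Data.Nat.Properties as ℕₚ
import Data.Nat.Tactic.RingSolver as ℕ-Solver
open import Data.Product using (_×_; _,_; proj₁; proj₂; ∃; uncurry)
open import Data.Rational using (_+_; -_; 1/_; _⊔_; ≢-nonZero; toℚᵘ; NonZero; nonNegative; positive)
open import Data.Rational.Properties
import Data.Rational.Unnormalised as ℚᵘ
import Data.Rational.Unnormalised.Properties as ℚᵘₚ
open import Data.Sum using (_⊎_; inj₁; inj₂; [_,_]′)
open import Function using (id; _∘_)
open import Level using (0ℓ)
open import Relation.Binary.PropositionalEquality using (_≡_; refl; sym; trans; cong; cong₂; subst; module ≡-Reasoning)
open import Relation.Nullary using (yes; no)
open import Relation.Nullary.Decidable using (⌊_⌋; dec⇒maybe; isYes≗does; dec-true; dec-false)
open import Relation.Nullary.Reflects using (ofʸ; ofⁿ)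
open import Tactic.RingSolver using (solve-∀)
import Tactic.RingSolver.Core.AlmostCommutativeRing as ACR

-- Rational arithmetic

ℚ-ring : ACR.AlmostCommutativeRing 0ℓ 0ℓ
ℚ-ring = ACR.fromCommutativeRing +-*-commutativeRing (λ q → dec⇒maybe (0ℚ ≟ q))

*-nonNeg : ∀ {p q} → 0ℚ ≤ p → 0ℚ ≤ q → 0ℚ ≤ p * q
*-nonNeg {p} {q} 0≤p 0≤q =
  nonNegative⁻¹ (p * q) {{nonNeg*nonNeg⇒nonNeg p {{nonNegative 0≤p}} q {{nonNegative 0≤q}}}}

*-monoˡ-≤-0≤ : ∀ {r p q} → 0ℚ ≤ r → p ≤ q → r * p ≤ r * q
*-monoˡ-≤-0≤ {r} 0≤r = *-monoˡ-≤-nonNeg r {{nonNegative 0≤r}}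

0≤1 : 0ℚ ≤ 1ℚ
0≤1 = nonNegative⁻¹ 1ℚ

^'-nonNeg : ∀ {p} k → 0ℚ ≤ p → 0ℚ ≤ p ^' k
^'-nonNeg zero    _   = 0≤1
^'-nonNeg (suc k) 0≤p = *-nonNeg 0≤p (^'-nonNeg k 0≤p)

p≤p+q : ∀ {p q} → 0ℚ ≤ q → p ≤ p + q
p≤p+q {p} {q} 0≤q = subst (_≤ p + q) (+-identityʳ p) (+-monoʳ-≤ p 0≤q)

p≤q+p : ∀ {p q} → 0ℚ ≤ q → p ≤ q + p
p≤q+p {p} {q} 0≤q = subst (p ≤_) (+-comm p q) (p≤p+q 0≤q)

p≤q⇒0≤q-p : ∀ {p q} → p ≤ q → 0ℚ ≤ q - p
p≤q⇒0≤q-p {p} {q} p≤q = subst (_≤ q - p) (+-inverseʳ p) (+-monoˡ-≤ (- p) p≤q)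

p≤q+r⇒p-r≤q : ∀ {p q r} → p ≤ q + r → p - r ≤ q
p≤q+r⇒p-r≤q {p} {q} {r} p≤q+r = subst (p - r ≤_) (cancel q r) (+-monoˡ-≤ (- r) p≤q+r)
  where
  cancel : ∀ q r → q + r - r ≡ q
  cancel = solve-∀ ℚ-ring

deficit-product-≤ : ∀ {s u v g} → 0ℚ ≤ s → 0ℚ ≤ u → 0ℚ ≤ v → s - v ≤ g → g ≤ s →
                    s * (s - u - v) ≤ (s - u) * g
deficit-product-≤ {s} {u} {v} {g} 0≤s 0≤u 0≤v s-v≤g g≤s with ≤-total u s
... | inj₁ u≤s = begin
  s * (s - u - v)          ≤⟨ p≤p+q (*-nonNeg 0≤u 0≤v) ⟩
  s * (s - u - v) + u * v  ≡⟨ expand s u v ⟩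
  (s - u) * (s - v)        ≤⟨ *-monoˡ-≤-0≤ (p≤q⇒0≤q-p u≤s) s-v≤g ⟩
  (s - u) * g              ∎
  where
  open ≤-Reasoning
  expand : ∀ s u v → s * (s - u - v) + u * v ≡ (s - u) * (s - v)
  expand = solve-∀ ℚ-ring
... | inj₂ s≤u = begin
  s * (s - u - v)                      ≤⟨ p≤p+q (*-nonNeg 0≤s 0≤v) ⟩
  s * (s - u - v) + s * v              ≡⟨ collect s u v ⟩
  (s - u) * s                          ≤⟨ p≤p+q (*-nonNeg (p≤q⇒0≤q-p s≤u) (p≤q⇒0≤q-p g≤s)) ⟩
  (s - u) * s + (u - s) * (s - g)      ≡⟨ factor s u g ⟩
  (s - u) * g                          ∎
  where
  open ≤-Reasoning
  collect : ∀ s u v → s * (s - u - v) + s * v ≡ (s - u) * s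
  collect = solve-∀ ℚ-ring
  factor : ∀ s u g → (s - u) * s + (u - s) * (s - g) ≡ (s - u) * g
  factor = solve-∀ ℚ-ring

÷'-≡ : ∀ p {q} (q≢0 : q ≢ 0ℚ) → p ÷' q ≡ p * (1/ q) {{≢-nonZero q≢0}}
÷'-≡ p {q} q≢0 with q ≟ 0ℚ
... | yes q≡0 = ⊥-elim (q≢0 q≡0)
... | no  _   = refl

*-÷'-cancel : ∀ p {q} → q ≢ 0ℚ → q * (p ÷' q) ≡ p
*-÷'-cancel p {q} q≢0 = begin
  q * (p ÷' q)     ≡⟨ cong (q *_) (÷'-≡ p q≢0) ⟩
  q * (p * 1/ q)   ≡⟨ swap q p (1/ q) ⟩
  p * (1/ q * q)   ≡⟨ cong (p *_) (*-inverseˡ q) ⟩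
  p * 1ℚ           ≡⟨ *-identityʳ p ⟩
  p                ∎
  where
  open ≡-Reasoning
  instance
    q-nonZero : NonZero q
    q-nonZero = ≢-nonZero q≢0
  swap : ∀ q p x → q * (p * x) ≡ p * (x * q)
  swap = solve-∀ ℚ-ring

*-÷'-cancelˡ : ∀ p {q} → q ≢ 0ℚ → (q * p) ÷' q ≡ p
*-÷'-cancelˡ p {q} q≢0 = begin
  (q * p) ÷' q     ≡⟨ ÷'-≡ (q * p) q≢0 ⟩
  q * p * 1/ q     ≡⟨ swap q p (1/ q) ⟩
  p * (1/ q * q)   ≡⟨ cong (p *_) (*-inverseˡ q) ⟩
  p * 1ℚ           ≡⟨ *-identityʳ p ⟩
  p                ∎
  where
  open ≡-Reasoning
  instance
    q-nonZero : NonZero q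
    q-nonZero = ≢-nonZero q≢0
  swap : ∀ q p x → q * p * x ≡ p * (x * q)
  swap = solve-∀ ℚ-ring

÷'-*-÷' : ∀ p {q r} → q ≢ 0ℚ → r ≢ 0ℚ → (p ÷' q) * (q ÷' r) ≡ p ÷' r
÷'-*-÷' p {q} {r} q≢0 r≢0 = begin
  (p ÷' q) * (q ÷' r)          ≡⟨ cong₂ _*_ (÷'-≡ p q≢0) (÷'-≡ q r≢0) ⟩
  (p * 1/ q) * (q * 1/ r)      ≡⟨ swap p q (1/ q) (1/ r) ⟩
  (p * 1/ r) * (1/ q * q)      ≡⟨ cong ((p * 1/ r) *_) (*-inverseˡ q) ⟩
  (p * 1/ r) * 1ℚ              ≡⟨ *-identityʳ _ ⟩
  p * 1/ r                     ≡⟨ ÷'-≡ p r≢0 ⟨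
  p ÷' r                       ∎
  where
  open ≡-Reasoning
  instance
    q-nonZero : NonZero q
    q-nonZero = ≢-nonZero q≢0
    r-nonZero : NonZero r
    r-nonZero = ≢-nonZero r≢0
  swap : ∀ p q x y → (p * x) * (q * y) ≡ (p * y) * (x * q)
  swap = solve-∀ ℚ-ring

-- ℕ→ℚ k is definitionally fromℚᵘ (mkℚᵘ (+ k) 0), so additivity is checked in ℚᵘ.
ℕ→ℚ-+ : ∀ m k → ℕ→ℚ (m ℕ.+ k) ≡ ℕ→ℚ m + ℕ→ℚ k
ℕ→ℚ-+ m k = toℚᵘ-injective (begin
  toℚᵘ (ℕ→ℚ (m ℕ.+ k))                       ≈⟨ toℚᵘ-fromℚᵘ _ ⟩
  ℚᵘ.mkℚᵘ (ℤ.+ (m ℕ.+ k)) 0                  ≈⟨ ℚᵘ.*≡* (+-over-1 (ℤ.+ m) (ℤ.+ k)) ⟩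
  ℚᵘ.mkℚᵘ (ℤ.+ m) 0 ℚᵘ.+ ℚᵘ.mkℚᵘ (ℤ.+ k) 0   ≈⟨ ℚᵘₚ.+-cong (toℚᵘ-fromℚᵘ (ℚᵘ.mkℚᵘ (ℤ.+ m) 0))
                                                               (toℚᵘ-fromℚᵘ (ℚᵘ.mkℚᵘ (ℤ.+ k) 0)) ⟨
  toℚᵘ (ℕ→ℚ m) ℚᵘ.+ toℚᵘ (ℕ→ℚ k)             ≈⟨ toℚᵘ-homo-+ (ℕ→ℚ m) (ℕ→ℚ k) ⟨
  toℚᵘ (ℕ→ℚ m + ℕ→ℚ k)                       ∎)
  where
  open ℚᵘₚ.≃-Reasoning
  +-over-1 : ∀ x y → (x ℤ.+ y) ℤ.* ℤ.+ 1 ≡ (x ℤ.* ℤ.+ 1 ℤ.+ y ℤ.* ℤ.+ 1) ℤ.* ℤ.+ 1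
  +-over-1 = ℤ-Solver.solve-∀

ℕ→ℚ-injective : ∀ {m k} → ℕ→ℚ m ≡ ℕ→ℚ k → m ≡ k
ℕ→ℚ-injective {m} {k} eq with ℚᵘₚ.≃-trans (ℚᵘₚ.≃-sym (toℚᵘ-fromℚᵘ (ℚᵘ.mkℚᵘ (ℤ.+ m) 0)))
                                          (ℚᵘₚ.≃-trans (toℚᵘ-cong eq) (toℚᵘ-fromℚᵘ (ℚᵘ.mkℚᵘ (ℤ.+ k) 0)))
... | ℚᵘ.*≡* m*1≡k*1 = ℤₚ.+-injective (trans (sym (ℤₚ.*-identityʳ (ℤ.+ m)))
                                             (trans m*1≡k*1 (ℤₚ.*-identityʳ (ℤ.+ k))))

ℕ→ℚ-nonNeg : ∀ k → 0ℚ ≤ ℕ→ℚ k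
ℕ→ℚ-nonNeg k = nonNegative⁻¹ _ {{normalize-nonNeg k 1}}

-- Finite sums and products

∑ : {A : Set} → List A → (A → ℚ) → ℚ
∑ xs f = sumℚ (map f xs)

∏ : {A : Set} → List A → (A → ℚ) → ℚ
∏ xs f = foldr _*_ 1ℚ (map f xs)

module _ {A : Set} where

  ∑-cong : ∀ xs {f g : A → ℚ} → (∀ x → f x ≡ g x) → ∑ xs f ≡ ∑ xs g
  ∑-cong []       f≗g = refl
  ∑-cong (x ∷ xs) f≗g = cong₂ _+_ (f≗g x) (∑-cong xs f≗g)

  ∑-+ : ∀ xs (f g : A → ℚ) → ∑ xs (λ x → f x + g x) ≡ ∑ xs f + ∑ xs g
  ∑-+ []       f g = refl
  ∑-+ (x ∷ xs) f g = trans (cong (f x + g x +_) (∑-+ xs f g)) (interchange (f x) (g x) (∑ xs f) (∑ xs g))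
    where
    interchange : ∀ a b c e → a + b + (c + e) ≡ a + c + (b + e)
    interchange = solve-∀ ℚ-ring

  ∑-*ˡ : ∀ xs c (f : A → ℚ) → ∑ xs (λ x → c * f x) ≡ c * ∑ xs f
  ∑-*ˡ []       c f = sym (*-zeroʳ c)
  ∑-*ˡ (x ∷ xs) c f = trans (cong (c * f x +_) (∑-*ˡ xs c f)) (sym (*-distribˡ-+ c (f x) (∑ xs f)))

  ∑-mono : ∀ xs {f g : A → ℚ} → (∀ x → f x ≤ g x) → ∑ xs f ≤ ∑ xs g
  ∑-mono []       f≤g = ≤-refl
  ∑-mono (x ∷ xs) f≤g = +-mono-≤ (f≤g x) (∑-mono xs f≤g)

  ∑-zero : ∀ xs {f : A → ℚ} → (∀ x → f x ≡ 0ℚ) → ∑ xs f ≡ 0ℚ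
  ∑-zero []       f≡0 = refl
  ∑-zero (x ∷ xs) f≡0 = trans (cong₂ _+_ (f≡0 x) (∑-zero xs f≡0)) (+-identityˡ 0ℚ)

  ∑-nonNeg : ∀ xs {f : A → ℚ} → (∀ x → 0ℚ ≤ f x) → 0ℚ ≤ ∑ xs f
  ∑-nonNeg []       0≤f = ≤-refl
  ∑-nonNeg (x ∷ xs) 0≤f = +-mono-≤ (0≤f x) (∑-nonNeg xs 0≤f)

  ∈⇒≤∑ : ∀ {xs x} {f : A → ℚ} → (∀ y → 0ℚ ≤ f y) → x ∈ xs → f x ≤ ∑ xs f
  ∈⇒≤∑ {_ ∷ xs} 0≤f (here refl)     = p≤p+q (∑-nonNeg xs 0≤f)
  ∈⇒≤∑ {y ∷ xs} 0≤f (there x∈xs) = ≤-trans (∈⇒≤∑ 0≤f x∈xs) (p≤q+p (0≤f y))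

  ∑-positive⇒∃ : ∀ xs {f : A → ℚ} → 0ℚ < ∑ xs f → ∃ λ x → 0ℚ < f x
  ∑-positive⇒∃ []       0<0 = ⊥-elim (<-irrefl refl 0<0)
  ∑-positive⇒∃ (x ∷ xs) {f} 0<∑ with 0ℚ <? f x
  ... | yes 0<fx = x , 0<fx
  ... | no  0≮fx = ∑-positive⇒∃ xs (<-≤-trans 0<∑ (subst (f x + ∑ xs f ≤_) (+-identityˡ (∑ xs f))
                                                         (+-monoˡ-≤ (∑ xs f) (≮⇒≥ 0≮fx))))

  ∑-++ : ∀ xs ys (f : A → ℚ) → ∑ (xs ++ ys) f ≡ ∑ xs f + ∑ ys f
  ∑-++ []       ys f = sym (+-identityˡ (∑ ys f))
  ∑-++ (x ∷ xs) ys f = trans (cong (f x +_) (∑-++ xs ys f)) (sym (+-assoc (f x) (∑ xs f) (∑ ys f)))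

  ∑-concatMap : ∀ {B : Set} (xs : List B) (g : B → List A) (f : A → ℚ) →
                ∑ (concatMap g xs) f ≡ ∑ xs (λ x → ∑ (g x) f)
  ∑-concatMap []       g f = refl
  ∑-concatMap (x ∷ xs) g f = trans (∑-++ (g x) (concatMap g xs) f) (cong (∑ (g x) f +_) (∑-concatMap xs g f))

  ∑-map : ∀ {B : Set} (xs : List B) (g : B → A) (f : A → ℚ) → ∑ (map g xs) f ≡ ∑ xs (f ∘ g)
  ∑-map []       g f = refl
  ∑-map (x ∷ xs) g f = cong (f (g x) +_) (∑-map xs g f)

  ∏-nonNeg : ∀ xs {f : A → ℚ} → (∀ x → 0ℚ ≤ f x) → 0ℚ ≤ ∏ xs f
  ∏-nonNeg []       0≤f = 0≤1
  ∏-nonNeg (x ∷ xs) 0≤f = *-nonNeg (0≤f x) (∏-nonNeg xs 0≤f)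

∑-allFin-suc : ∀ {m} (f : Fin (suc m) → ℚ) → ∑ (allFin (suc m)) f ≡ f F.zero + ∑ (allFin m) (f ∘ F.suc)
∑-allFin-suc f = cong (λ xs → f F.zero + sumℚ xs)
  (trans (Listₚ.map-tabulate F.suc f) (sym (Listₚ.map-tabulate id (f ∘ F.suc))))

≤-foldr-⊔ : ∀ {x xs} z → x ∈ xs → x ≤ foldr _⊔_ z xs
≤-foldr-⊔               z (here refl)  = p≤p⊔q _ _
≤-foldr-⊔ {xs = y ∷ ys} z (there x∈ys) = p≤q⇒p≤r⊔q y (≤-foldr-⊔ z x∈ys)

foldr-⊔-≥ : ∀ z xs → z ≤ foldr _⊔_ z xs
foldr-⊔-≥ z []       = ≤-refl
foldr-⊔-≥ z (x ∷ xs) = p≤q⇒p≤r⊔q x (foldr-⊔-≥ z xs)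

[_] : Bool → ℚ
[ true  ] = 1ℚ
[ false ] = 0ℚ

[]-nonNeg : ∀ b → 0ℚ ≤ [ b ]
[]-nonNeg true  = 0≤1
[]-nonNeg false = ≤-refl

[∧] : ∀ a b → [ a ∧ b ] ≡ [ a ] * [ b ]
[∧] true  b = sym (*-identityˡ [ b ])
[∧] false b = sym (*-zeroˡ [ b ])

[]-*-≤ : ∀ b {g} → 0ℚ ≤ g → [ b ] * g ≤ g
[]-*-≤ true  {g} _   = ≤-reflexive (*-identityˡ g)
[]-*-≤ false {g} 0≤g = subst (_≤ g) (sym (*-zeroˡ g)) 0≤g

[]-*-cong : ∀ b {x y} → (b ≡ true → x ≡ y) → [ b ] * x ≡ [ b ] * y
[]-*-cong true  x≡y = cong (1ℚ *_) (x≡y refl)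
[]-*-cong false {x} {y} _ = trans (*-zeroˡ x) (sym (*-zeroˡ y))

[not]-*-≤ : ∀ u v {g} → 0ℚ ≤ g → [ not v ] * g ≤ [ not (u ∨ v) ] * g + [ u ] * g
[not]-*-≤ true  true  {g} 0≤g = p≤p+q (*-nonNeg 0≤1 0≤g)
[not]-*-≤ true  false {g} 0≤g = ≤-reflexive (sym (trans (cong (_+ 1ℚ * g) (*-zeroˡ g)) (+-identityˡ _)))
[not]-*-≤ false v     {g} 0≤g = ≤-reflexive (sym (trans (cong ([ not v ] * g +_) (*-zeroˡ g)) (+-identityʳ _)))

∑-if : ∀ {A : Set} c (x : A) f → ∑ (if c then x ∷ [] else []) f ≡ [ c ] * f x
∑-if true  x f = trans (+-identityʳ (f x)) (sym (*-identityˡ (f x)))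
∑-if false x f = sym (*-zeroˡ (f x))

⌊≟⌋-refl : ∀ {m} (a : Fin m) → ⌊ a Fₚ.≟ a ⌋ ≡ true
⌊≟⌋-refl a = trans (isYes≗does (a Fₚ.≟ a)) (dec-true (a Fₚ.≟ a) refl)

⌊≟⌋-≢ : ∀ {m} {i a : Fin m} → i ≢ a → ⌊ i Fₚ.≟ a ⌋ ≡ false
⌊≟⌋-≢ {i = i} {a} i≢a = trans (isYes≗does (i Fₚ.≟ a)) (dec-false (i Fₚ.≟ a) i≢a)

∑-allFin-single : ∀ {m} (h : Fin m → ℚ) a → (∀ i → i ≢ a → h i ≡ 0ℚ) → ∑ (allFin m) h ≡ h a
∑-allFin-single {suc m} h F.zero h≡0 = begin
  ∑ (allFin (suc m)) h                     ≡⟨ ∑-allFin-suc h ⟩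
  h F.zero + ∑ (allFin m) (h ∘ F.suc)      ≡⟨ cong (h F.zero +_) (∑-zero (allFin m) (λ i → h≡0 (F.suc i) λ ())) ⟩
  h F.zero + 0ℚ                            ≡⟨ +-identityʳ (h F.zero) ⟩
  h F.zero                                 ∎
  where open ≡-Reasoning
∑-allFin-single {suc m} h (F.suc a) h≡0 = begin
  ∑ (allFin (suc m)) h                     ≡⟨ ∑-allFin-suc h ⟩
  h F.zero + ∑ (allFin m) (h ∘ F.suc)      ≡⟨ cong₂ _+_ (h≡0 F.zero λ ())
                                                          (∑-allFin-single (h ∘ F.suc) a h∘suc≡0) ⟩
  0ℚ + h (F.suc a)                         ≡⟨ +-identityˡ (h (F.suc a)) ⟩
  h (F.suc a)                              ∎
  where
  open ≡-Reasoning
  h∘suc≡0 : ∀ i → i ≢ a → h (F.suc i) ≡ 0ℚ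
  h∘suc≡0 i i≢a = h≡0 (F.suc i) (i≢a ∘ Fₚ.suc-injective)

∑-δ : ∀ {m} (a : Fin m) (f : Fin m → ℚ) → ∑ (allFin m) (λ i → [ ⌊ i Fₚ.≟ a ⌋ ] * f i) ≡ f a
∑-δ a f = begin
  ∑ (allFin _) (λ i → [ ⌊ i Fₚ.≟ a ⌋ ] * f i)   ≡⟨ ∑-allFin-single _ a off-diagonal ⟩
  [ ⌊ a Fₚ.≟ a ⌋ ] * f a                        ≡⟨ cong (λ b → [ b ] * f a) (⌊≟⌋-refl a) ⟩
  1ℚ * f a                                      ≡⟨ *-identityˡ (f a) ⟩
  f a                                           ∎
  where
  open ≡-Reasoning
  off-diagonal : ∀ i → i ≢ a → [ ⌊ i Fₚ.≟ a ⌋ ] * f i ≡ 0ℚ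
  off-diagonal i i≢a = trans (cong (λ b → [ b ] * f i) (⌊≟⌋-≢ i≢a)) (*-zeroˡ (f i))

all-false : ∀ {A : Set} {f : A → Bool} {xs} → Any (λ x → f x ≡ false) xs → all f xs ≡ false
all-false {f = f} {x ∷ xs} (here fx≡false) = cong (_∧ all f xs) fx≡false
all-false {f = f} {x ∷ xs} (there fxs)      = trans (cong (f x ∧_) (all-false fxs)) (𝔹.∧-zeroʳ (f x))

-- Expectations over independent edges

module Expectation {E : Set} (q : E → ℚ) where

  -- 𝔼 es f is the expectation of f G, where the random sublist G of es keeps each e
  -- independently with probability q e; the recursion conditions on the first element.
  𝔼 : List E → (List E → ℚ) → ℚ
  𝔼 []       f = f []
  𝔼 (e ∷ es) f = 𝔼 es (λ G → q e * f (e ∷ G) + (1ℚ - q e) * f G)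

  𝔼-cong : ∀ es {f g} → (∀ G → f G ≡ g G) → 𝔼 es f ≡ 𝔼 es g
  𝔼-cong []       f≗g = f≗g []
  𝔼-cong (e ∷ es) f≗g = 𝔼-cong es (λ G → cong₂ (λ x y → q e * x + (1ℚ - q e) * y) (f≗g (e ∷ G)) (f≗g G))

  𝔼-+ : ∀ es f g → 𝔼 es (λ G → f G + g G) ≡ 𝔼 es f + 𝔼 es g
  𝔼-+ []       f g = refl
  𝔼-+ (e ∷ es) f g =
    trans (𝔼-cong es (λ G → split (q e) (f (e ∷ G)) (g (e ∷ G)) (f G) (g G))) (𝔼-+ es _ _)
    where
    split : ∀ r a b c d → r * (a + b) + (1ℚ - r) * (c + d) ≡ (r * a + (1ℚ - r) * c) + (r * b + (1ℚ - r) * d)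
    split = solve-∀ ℚ-ring

  𝔼-*ˡ : ∀ es c f → 𝔼 es (λ G → c * f G) ≡ c * 𝔼 es f
  𝔼-*ˡ []       c f = refl
  𝔼-*ˡ (e ∷ es) c f = trans (𝔼-cong es (λ G → pull (q e) c (f (e ∷ G)) (f G))) (𝔼-*ˡ es c _)
    where
    pull : ∀ r c a b → r * (c * a) + (1ℚ - r) * (c * b) ≡ c * (r * a + (1ℚ - r) * b)
    pull = solve-∀ ℚ-ring

  𝔼-const : ∀ es c → 𝔼 es (λ _ → c) ≡ c
  𝔼-const []       c = refl
  𝔼-const (e ∷ es) c = trans (𝔼-cong es (λ _ → mix (q e) c)) (𝔼-const es c)
    where
    mix : ∀ r c → r * c + (1ℚ - r) * c ≡ c
    mix = solve-∀ ℚ-ring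

  𝔼-∑ : ∀ es {A : Set} (xs : List A) (F : A → List E → ℚ) →
        𝔼 es (λ G → ∑ xs (λ x → F x G)) ≡ ∑ xs (λ x → 𝔼 es (F x))
  𝔼-∑ es []       F = 𝔼-const es 0ℚ
  𝔼-∑ es (x ∷ xs) F = trans (𝔼-+ es (F x) _) (cong (𝔼 es (F x) +_) (𝔼-∑ es xs F))

  𝔼-vanishing : ∀ es {f} → (∀ {G} → G ⊆ es → f G ≡ 0ℚ) → 𝔼 es f ≡ 0ℚ
  𝔼-vanishing []       f≡0 = f≡0 []
  𝔼-vanishing (e ∷ es) f≡0 = 𝔼-vanishing es (λ G⊆es →
    trans (cong₂ (λ x y → q e * x + (1ℚ - q e) * y) (f≡0 (refl ∷ G⊆es)) (f≡0 (e ∷ʳ G⊆es))) (annihilate (q e)))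
    where
    annihilate : ∀ r → r * 0ℚ + (1ℚ - r) * 0ℚ ≡ 0ℚ
    annihilate = solve-∀ ℚ-ring

-- Simple paths in the Chung-Lu graph

module SimplePaths {n : ℕ} (d : Fin n → ℚ) where
  open ChungLu d
  open Expectation (uncurry p)

  ℕ→ℚ-count : ∀ {A : Set} (P : A → Bool) xs → ℕ→ℚ (count P xs) ≡ ∑ xs (λ x → [ P x ])
  ℕ→ℚ-count P []       = refl
  ℕ→ℚ-count P (x ∷ xs) with P x
  ... | true  = trans (ℕ→ℚ-+ 1 (count P xs)) (cong (1ℚ +_) (ℕ→ℚ-count P xs))
  ... | false = trans (ℕ→ℚ-count P xs) (sym (+-identityˡ (∑ xs (λ x → [ P x ]))))

  ==-≡ : ∀ {x y} → (x == y) ≡ true → x ≡ y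
  ==-≡ {x} {y} with x Fₚ.≟ y
  ... | yes x≡y = λ _ → x≡y
  ... | no  _   = λ ()

  ==-sym : ∀ x y → (x == y) ≡ (y == x)
  ==-sym x y with x Fₚ.≟ y | y Fₚ.≟ x
  ... | yes _   | yes _   = refl
  ... | no  _   | no  _   = refl
  ... | yes x≡y | no  y≢x = ⊥-elim (y≢x (sym x≡y))
  ... | no  x≢y | yes y≡x = ⊥-elim (x≢y (sym y≡x))

  notIn-∷ : ∀ x y ys → notIn x (y ∷ ys) ≡ true → x ≢ y × notIn x ys ≡ true
  notIn-∷ x y ys with x Fₚ.≟ y
  ... | yes _   = λ ()
  ... | no  x≢y = λ x∉ys → x≢y , x∉ys

  notIn-∷⁺ : ∀ {x y ys} → x ≢ y → notIn x ys ≡ true → notIn x (y ∷ ys) ≡ true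
  notIn-∷⁺ {x} {y} {ys} x≢y x∉ys = trans (cong (λ b → not (b ∨ any (x ==_) ys)) (⌊≟⌋-≢ x≢y)) x∉ys

  distinct-∷ : ∀ x xs → distinct (x ∷ xs) ≡ true → notIn x xs ≡ true × distinct xs ≡ true
  distinct-∷ x xs dxs = 𝔹.∧-conicalˡ _ _ dxs , 𝔹.∧-conicalʳ _ _ dxs

  covers : Fin n × Fin n → Fin n × Fin n → Bool
  covers (i , j) (a , b) = ((i == a) ∧ (j == b)) ∨ ((i == b) ∧ (j == a))

  covers⇒≡ : ∀ i j a b → covers (i , j) (a , b) ≡ true → (i ≡ a × j ≡ b) ⊎ (i ≡ b × j ≡ a)
  covers⇒≡ i j a b with (i == a) ∧ (j == b) in ij≡ab
  ... | true  = λ _ → inj₁ (==-≡ (𝔹.∧-conicalˡ _ _ ij≡ab) , ==-≡ (𝔹.∧-conicalʳ _ _ ij≡ab))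
  ... | false = λ ij≡ba → inj₂ (==-≡ (𝔹.∧-conicalˡ _ _ ij≡ba) , ==-≡ (𝔹.∧-conicalʳ _ _ ij≡ba))

  covers⇒p≡ : ∀ e r → covers e r ≡ true → uncurry p r ≡ uncurry p e
  covers⇒p≡ (i , j) (a , b) eab with covers⇒≡ i j a b eab
  ... | inj₁ (refl , refl) = refl
  ... | inj₂ (refl , refl) = cong (_÷' S) (*-comm (d j) (d i))

  covers-shared : ∀ e {x y c c′} → covers e (x , y) ≡ true → covers e (c , c′) ≡ true → x ≡ c ⊎ x ≡ c′
  covers-shared (i , j) exy ecc with covers⇒≡ i j _ _ exy | covers⇒≡ i j _ _ ecc
  ... | inj₁ (refl , _) | inj₁ (refl , _) = inj₁ refl
  ... | inj₁ (refl , _) | inj₂ (refl , _) = inj₂ refl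
  ... | inj₂ (_ , refl) | inj₁ (_ , refl) = inj₂ refl
  ... | inj₂ (_ , refl) | inj₂ (_ , refl) = inj₁ refl

  allAdjacent : Graph → List (Fin n × Fin n) → Bool
  allAdjacent G = all (uncurry (adj G))

  uncoveredBy : Fin n × Fin n → List (Fin n × Fin n) → List (Fin n × Fin n)
  uncoveredBy e []      = []
  uncoveredBy e (r ∷ R) = if covers e r then uncoveredBy e R else r ∷ uncoveredBy e R

  allAdjacent-∷ : ∀ e G R → allAdjacent (e ∷ G) R ≡ allAdjacent G (uncoveredBy e R)
  allAdjacent-∷ e G []      = refl
  allAdjacent-∷ e G (r ∷ R) with covers e r
  ... | true  = allAdjacent-∷ e G R
  ... | false = cong (uncurry (adj G) r ∧_) (allAdjacent-∷ e G R)

  coverCount : List (Fin n × Fin n) → Fin n × Fin n → ℕ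
  coverCount es r = count (λ e → covers e r) es

  edgeWeight : List (Fin n × Fin n) → ℚ
  edgeWeight R = ∏ R (uncurry p)

  uncoveredBy-id : ∀ e R → count (covers e) R ≡ 0 → uncoveredBy e R ≡ R
  uncoveredBy-id e []      = λ _ → refl
  uncoveredBy-id e (r ∷ R) with covers e r
  ... | true  = λ ()
  ... | false = λ c≡0 → cong (r ∷_) (uncoveredBy-id e R c≡0)

  count-uncoveredBy-≤ : ∀ P e R → count P (uncoveredBy e R) ℕ.≤ count P R
  count-uncoveredBy-≤ P e []      = ℕ.z≤n
  count-uncoveredBy-≤ P e (r ∷ R) with covers e r
  ... | true with P r
  ...   | true  = ℕₚ.m≤n⇒m≤1+n (count-uncoveredBy-≤ P e R)
  ...   | false = count-uncoveredBy-≤ P e R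
  count-uncoveredBy-≤ P e (r ∷ R) | false with P r
  ...   | true  = ℕ.s≤s (count-uncoveredBy-≤ P e R)
  ...   | false = count-uncoveredBy-≤ P e R

  edgeWeight-uncoveredBy : ∀ e R → count (covers e) R ≡ 1 → edgeWeight R ≡ uncurry p e * edgeWeight (uncoveredBy e R)
  edgeWeight-uncoveredBy e []      ()
  edgeWeight-uncoveredBy e (r ∷ R) with covers e r in er
  ... | true  = λ c≡1 → cong₂ _*_ (covers⇒p≡ e r er)
                                  (cong edgeWeight (sym (uncoveredBy-id e R (ℕₚ.suc-injective c≡1))))
  ... | false = λ c≡1 → trans (cong (uncurry p r *_) (edgeWeight-uncoveredBy e R c≡1))
                              (swap (uncurry p r) (uncurry p e) (edgeWeight (uncoveredBy e R)))
    where
    swap : ∀ x y z → x * (y * z) ≡ y * (x * z)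
    swap = solve-∀ ℚ-ring

  coverCount-uncoveredBy : ∀ e es R → All (λ r → coverCount (e ∷ es) r ≡ 1) R →
                           All (λ r → coverCount es r ≡ 1) (uncoveredBy e R)
  coverCount-uncoveredBy e es []      []       = []
  coverCount-uncoveredBy e es (r ∷ R) (c≡1 ∷ cs) with covers e r
  ... | true  = coverCount-uncoveredBy e es R cs
  ... | false = c≡1 ∷ coverCount-uncoveredBy e es R cs

  uncovered-witness : ∀ e es R {k} → count (covers e) R ≡ suc k → All (λ r → coverCount (e ∷ es) r ≡ 1) R →
                      Any (λ r → coverCount es r ≡ 0) R
  uncovered-witness e es (r ∷ R) c (c≡1 ∷ cs) with covers e r
  ... | true  = here (ℕₚ.suc-injective c≡1)
  ... | false = there (uncovered-witness e es R c cs)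

  ⊆-uncovered : ∀ {P : Fin n × Fin n → Bool} {G es} → G ⊆ es → count P es ≡ 0 → any P G ≡ false
  ⊆-uncovered []                          _   = refl
  ⊆-uncovered {P} (e ∷ʳ G⊆es)             c≡0 with P e
  ... | true  = ⊥-elim (ℕₚ.1+n≢0 c≡0)
  ... | false = ⊆-uncovered G⊆es c≡0
  ⊆-uncovered {P} {e ∷ G} (refl ∷ G⊆es) c≡0 with P e
  ... | true  = ⊥-elim (ℕₚ.1+n≢0 c≡0)
  ... | false = ⊆-uncovered G⊆es c≡0

  𝔼-allAdjacent-uncovered : ∀ es R → Any (λ r → coverCount es r ≡ 0) R → 𝔼 es (λ G → [ allAdjacent G R ]) ≡ 0ℚ
  𝔼-allAdjacent-uncovered es R uncovered =
    𝔼-vanishing es (λ G⊆es → cong [_] (all-false (Any.map (⊆-uncovered G⊆es) uncovered)))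

  𝔼-allAdjacent-∷ : ∀ e es R → 𝔼 (e ∷ es) (λ G → [ allAdjacent G R ]) ≡
      uncurry p e * 𝔼 es (λ G → [ allAdjacent G (uncoveredBy e R) ])
    + (1ℚ - uncurry p e) * 𝔼 es (λ G → [ allAdjacent G R ])
  𝔼-allAdjacent-∷ e es R = begin
    𝔼 es (λ G → q * [ allAdjacent (e ∷ G) R ] + (1ℚ - q) * [ allAdjacent G R ])
      ≡⟨ 𝔼-cong es (λ G → cong (λ b → q * [ b ] + (1ℚ - q) * [ allAdjacent G R ]) (allAdjacent-∷ e G R)) ⟩
    𝔼 es (λ G → q * [ allAdjacent G (uncoveredBy e R) ] + (1ℚ - q) * [ allAdjacent G R ])
      ≡⟨ 𝔼-+ es _ _ ⟩
    𝔼 es (λ G → q * [ allAdjacent G (uncoveredBy e R) ]) + 𝔼 es (λ G → (1ℚ - q) * [ allAdjacent G R ])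
      ≡⟨ cong₂ _+_ (𝔼-*ˡ es q _) (𝔼-*ˡ es (1ℚ - q) _) ⟩
    q * 𝔼 es (λ G → [ allAdjacent G (uncoveredBy e R) ]) + (1ℚ - q) * 𝔼 es (λ G → [ allAdjacent G R ]) ∎
    where
    open ≡-Reasoning
    q : ℚ
    q = uncurry p e

  -- Induction on es: an edge covering no pair of R does not affect the event; the unique edge
  -- covering a pair contributes its probability, and without it that pair can never be adjacent.
  𝔼-allAdjacent : ∀ es R → All (λ r → coverCount es r ≡ 1) R → (∀ e → count (covers e) R ℕ.≤ 1) →
                  𝔼 es (λ G → [ allAdjacent G R ]) ≡ edgeWeight R
  𝔼-allAdjacent []       []      _          _      = refl
  𝔼-allAdjacent []       (r ∷ R) (() ∷ _)   _
  𝔼-allAdjacent (e ∷ es) R       uniquely   sparse with count (covers e) R in c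
  ... | 0 = begin
    𝔼 (e ∷ es) (λ G → [ allAdjacent G R ])
      ≡⟨ 𝔼-allAdjacent-∷ e es R ⟩
    q * 𝔼 es (λ G → [ allAdjacent G (uncoveredBy e R) ]) + (1ℚ - q) * 𝔼 es (λ G → [ allAdjacent G R ])
      ≡⟨ cong (λ R′ → q * 𝔼 es (λ G → [ allAdjacent G R′ ]) + (1ℚ - q) * 𝔼 es (λ G → [ allAdjacent G R ]))
              (uncoveredBy-id e R c) ⟩
    q * 𝔼 es (λ G → [ allAdjacent G R ]) + (1ℚ - q) * 𝔼 es (λ G → [ allAdjacent G R ])
      ≡⟨ cong (λ x → q * x + (1ℚ - q) * x) (𝔼-allAdjacent es R uniquely′ sparse) ⟩
    q * edgeWeight R + (1ℚ - q) * edgeWeight R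
      ≡⟨ mix q (edgeWeight R) ⟩
    edgeWeight R ∎
    where
    open ≡-Reasoning
    q : ℚ
    q = uncurry p e
    uniquely′ : All (λ r → coverCount es r ≡ 1) R
    uniquely′ = subst (All (λ r → coverCount es r ≡ 1)) (uncoveredBy-id e R c) (coverCount-uncoveredBy e es R uniquely)
    mix : ∀ r x → r * x + (1ℚ - r) * x ≡ x
    mix = solve-∀ ℚ-ring
  ... | 1 = begin
    𝔼 (e ∷ es) (λ G → [ allAdjacent G R ])
      ≡⟨ 𝔼-allAdjacent-∷ e es R ⟩
    q * 𝔼 es (λ G → [ allAdjacent G (uncoveredBy e R) ]) + (1ℚ - q) * 𝔼 es (λ G → [ allAdjacent G R ])
      ≡⟨ cong₂ (λ x y → q * x + (1ℚ - q) * y)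
               (𝔼-allAdjacent es (uncoveredBy e R) (coverCount-uncoveredBy e es R uniquely) sparse′)
               (𝔼-allAdjacent-uncovered es R (uncovered-witness e es R c uniquely)) ⟩
    q * edgeWeight (uncoveredBy e R) + (1ℚ - q) * 0ℚ
      ≡⟨ drop q (edgeWeight (uncoveredBy e R)) ⟩
    q * edgeWeight (uncoveredBy e R)
      ≡⟨ edgeWeight-uncoveredBy e R c ⟨
    edgeWeight R ∎
    where
    open ≡-Reasoning
    q : ℚ
    q = uncurry p e
    sparse′ : ∀ e′ → count (covers e′) (uncoveredBy e R) ℕ.≤ 1
    sparse′ e′ = ℕₚ.≤-trans (count-uncoveredBy-≤ (covers e′) e R) (sparse e′)
    drop : ∀ r x → r * x + (1ℚ - r) * 0ℚ ≡ r * x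
    drop = solve-∀ ℚ-ring
  ... | suc (suc k) = ⊥-elim (ℕₚ.≤⇒≯ (subst (ℕ._≤ 1) c (sparse e)) (ℕ.s≤s (ℕ.s≤s ℕ.z≤n)))

  ≤ᵇ-exclusive : ∀ {m k} → m ≢ k → [ m ℕ.≤ᵇ k ] + [ k ℕ.≤ᵇ m ] ≡ 1ℚ
  ≤ᵇ-exclusive {m} {k} m≢k with m ℕ.≤ᵇ k | ℕₚ.≤ᵇ-reflects-≤ m k | k ℕ.≤ᵇ m | ℕₚ.≤ᵇ-reflects-≤ k m
  ... | true  | ofʸ m≤k | true  | ofʸ k≤m = ⊥-elim (m≢k (ℕₚ.≤-antisym m≤k k≤m))
  ... | true  | _       | false | _       = refl
  ... | false | _       | true  | _       = refl
  ... | false | ofⁿ m≰k | false | ofⁿ k≰m = ⊥-elim (m≰k (ℕₚ.≰⇒≥ k≰m))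

  [covers] : ∀ {a b} → a ≢ b → ∀ i j → [ covers (i , j) (a , b) ] ≡ [ i == a ] * [ j == b ] + [ i == b ] * [ j == a ]
  [covers] {a} {b} a≢b i j with i Fₚ.≟ a | i Fₚ.≟ b
  ... | yes refl | yes refl = ⊥-elim (a≢b refl)
  ... | yes _    | no  _    = trans (cong [_] (𝔹.∨-identityʳ (j == b))) (first [ j == b ] [ j == a ])
    where
    first : ∀ x y → x ≡ 1ℚ * x + 0ℚ * y
    first = solve-∀ ℚ-ring
  ... | no  _    | yes _    = second [ j == b ] [ j == a ]
    where
    second : ∀ x y → y ≡ 0ℚ * x + 1ℚ * y
    second = solve-∀ ℚ-ring
  ... | no  _    | no  _    = neither [ j == b ] [ j == a ]
    where
    neither : ∀ x y → 0ℚ ≡ 0ℚ * x + 0ℚ * y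
    neither = solve-∀ ℚ-ring

  coverCount-Edges : ∀ {a b} → a ≢ b → coverCount Edges (a , b) ≡ 1
  coverCount-Edges {a} {b} a≢b = ℕ→ℚ-injective (begin
    ℕ→ℚ (coverCount Edges (a , b))
      ≡⟨ ℕ→ℚ-count (λ e → covers e (a , b)) Edges ⟩
    ∑ Edges (λ e → [ covers e (a , b) ])
      ≡⟨ trans (∑-concatMap (allFin n) _ _) (∑-cong (allFin n) (λ i →
           trans (∑-concatMap (allFin n) _ _)
                 (∑-cong (allFin n) (λ j → ∑-if (toℕ i ℕ.≤ᵇ toℕ j) (i , j) (λ e → [ covers e (a , b) ]))))) ⟩
    ∑ (allFin n) (λ i → ∑ (allFin n) (λ j → [ toℕ i ℕ.≤ᵇ toℕ j ] * [ covers (i , j) (a , b) ]))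
      ≡⟨ ∑-cong (allFin n) (λ i → ∑-cong (allFin n) (split i)) ⟩
    ∑ (allFin n) (λ i → ∑ (allFin n) (λ j → [ i == a ] * ([ j == b ] * [ toℕ i ℕ.≤ᵇ toℕ j ])
                                          + [ i == b ] * ([ j == a ] * [ toℕ i ℕ.≤ᵇ toℕ j ])))
      ≡⟨ ∑-cong (allFin n) inner ⟩
    ∑ (allFin n) (λ i → [ i == a ] * [ toℕ i ℕ.≤ᵇ toℕ b ] + [ i == b ] * [ toℕ i ℕ.≤ᵇ toℕ a ])
      ≡⟨ trans (∑-+ (allFin n) _ _) (cong₂ _+_ (∑-δ a _) (∑-δ b _)) ⟩
    [ toℕ a ℕ.≤ᵇ toℕ b ] + [ toℕ b ℕ.≤ᵇ toℕ a ]
      ≡⟨ ≤ᵇ-exclusive (a≢b ∘ Fₚ.toℕ-injective) ⟩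
    1ℚ ∎)
    where
    open ≡-Reasoning
    distribute : ∀ o x y z w → o * (x * y + z * w) ≡ x * (y * o) + z * (w * o)
    distribute = solve-∀ ℚ-ring
    split : ∀ i j → [ toℕ i ℕ.≤ᵇ toℕ j ] * [ covers (i , j) (a , b) ] ≡
                    [ i == a ] * ([ j == b ] * [ toℕ i ℕ.≤ᵇ toℕ j ])
                    + [ i == b ] * ([ j == a ] * [ toℕ i ℕ.≤ᵇ toℕ j ])
    split i j = trans (cong ([ toℕ i ℕ.≤ᵇ toℕ j ] *_) ([covers] a≢b i j))
                      (distribute [ toℕ i ℕ.≤ᵇ toℕ j ] [ i == a ] [ j == b ] [ i == b ] [ j == a ])
    inner : ∀ i → ∑ (allFin n) (λ j → [ i == a ] * ([ j == b ] * [ toℕ i ℕ.≤ᵇ toℕ j ])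
                                      + [ i == b ] * ([ j == a ] * [ toℕ i ℕ.≤ᵇ toℕ j ]))
                  ≡ [ i == a ] * [ toℕ i ℕ.≤ᵇ toℕ b ] + [ i == b ] * [ toℕ i ℕ.≤ᵇ toℕ a ]
    inner i = trans (∑-+ (allFin n) _ _)
      (cong₂ _+_ (trans (∑-*ˡ (allFin n) [ i == a ] _) (cong ([ i == a ] *_) (∑-δ b _)))
                 (trans (∑-*ˡ (allFin n) [ i == b ] _) (cong ([ i == b ] *_) (∑-δ a _))))

  steps : List (Fin n) → List (Fin n × Fin n)
  steps (x ∷ y ∷ xs) = (x , y) ∷ steps (y ∷ xs)
  steps _            = []

  endsAt : Fin n → List (Fin n) → Bool
  endsAt t []           = false
  endsAt t (x ∷ [])     = x == t
  endsAt t (x ∷ y ∷ xs) = endsAt t (y ∷ xs)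

  walkTo-≡ : ∀ G t xs → walkTo G t xs ≡ allAdjacent G (steps xs) ∧ endsAt t xs
  walkTo-≡ G t []           = refl
  walkTo-≡ G t (x ∷ [])     = refl
  walkTo-≡ G t (x ∷ y ∷ xs) =
    trans (cong (adj G x y ∧_) (walkTo-≡ G t (y ∷ xs))) (sym (𝔹.∧-assoc (adj G x y) _ _))

  steps-nonLoop : ∀ xs → distinct xs ≡ true → All (λ r → proj₁ r ≢ proj₂ r) (steps xs)
  steps-nonLoop []           _   = []
  steps-nonLoop (x ∷ [])     _   = []
  steps-nonLoop (x ∷ y ∷ xs) dxs =
    proj₁ (notIn-∷ x y xs (proj₁ (distinct-∷ x (y ∷ xs) dxs)))
    ∷ steps-nonLoop (y ∷ xs) (proj₂ (distinct-∷ x (y ∷ xs) dxs))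

  steps-uniquelyCovered : ∀ xs → distinct xs ≡ true → All (λ r → coverCount Edges r ≡ 1) (steps xs)
  steps-uniquelyCovered xs dxs = All.map coverCount-Edges (steps-nonLoop xs dxs)

  count-∷-false : ∀ {A : Set} (P : A → Bool) {x} xs → P x ≡ false → count P (x ∷ xs) ≡ count P xs
  count-∷-false P xs Px≡false = cong (λ b → if b then suc (count P xs) else count P xs) Px≡false

  count-∷-≤1 : ∀ {A : Set} (P : A → Bool) {x} xs → (P x ≡ true → count P xs ≡ 0) → count P xs ℕ.≤ 1 →
               count P (x ∷ xs) ℕ.≤ 1
  count-∷-≤1 P {x} xs with P x
  ... | true  = λ only _ → ℕₚ.≤-reflexive (cong suc (only refl))
  ... | false = λ _ ≤1 → ≤1

  steps-uncovered : ∀ e {x y} ys → covers e (x , y) ≡ true → notIn x ys ≡ true → count (covers e) (steps ys) ≡ 0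
  steps-uncovered e     []            _   _  = refl
  steps-uncovered e     (c ∷ [])      _   _  = refl
  steps-uncovered e {x} (c ∷ c′ ∷ zs) exy x∉ =
    trans (count-∷-false (covers e) (steps (c′ ∷ zs)) (𝔹.¬-not (x≢c ∘ covers-shared′)))
          (steps-uncovered e (c′ ∷ zs) exy x∉c′zs)
    where
    x∉c′zs : notIn x (c′ ∷ zs) ≡ true
    x∉c′zs = proj₂ (notIn-∷ x c (c′ ∷ zs) x∉)
    covers-shared′ : covers e (c , c′) ≡ true → x ≡ c ⊎ x ≡ c′
    covers-shared′ = covers-shared e exy
    x≢c : x ≡ c ⊎ x ≡ c′ → ⊥
    x≢c = [ proj₁ (notIn-∷ x c (c′ ∷ zs) x∉) , proj₁ (notIn-∷ x c′ zs x∉c′zs) ]′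

  steps-sparse : ∀ xs → distinct xs ≡ true → ∀ e → count (covers e) (steps xs) ℕ.≤ 1
  steps-sparse []           _   e = ℕ.z≤n
  steps-sparse (x ∷ [])     _   e = ℕ.z≤n
  steps-sparse (x ∷ y ∷ xs) dxs e =
    count-∷-≤1 (covers e) (steps (y ∷ xs))
      (λ exy → steps-uncovered e (y ∷ xs) exy (proj₁ (distinct-∷ x (y ∷ xs) dxs)))
      (steps-sparse (y ∷ xs) (proj₂ (distinct-∷ x (y ∷ xs) dxs)) e)

  avoids : List (Fin n) → List (Fin n) → Bool
  avoids xs F = all (λ x → notIn x F) xs

  simpleAvoiding : List (Fin n) → List (Fin n) → Bool
  simpleAvoiding F xs = avoids xs F ∧ distinct xs

  avoids-[] : ∀ xs → avoids xs [] ≡ true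
  avoids-[] []       = refl
  avoids-[] (x ∷ xs) = avoids-[] xs

  avoids-∷ : ∀ ys a F → avoids ys (a ∷ F) ≡ avoids ys F ∧ notIn a ys
  avoids-∷ []       a F = refl
  avoids-∷ (y ∷ ys) a F = begin
    not ((y == a) ∨ any (y ==_) F) ∧ avoids ys (a ∷ F)
      ≡⟨ cong₂ (λ u v → not (u ∨ any (y ==_) F) ∧ v) (==-sym y a) (avoids-∷ ys a F) ⟩
    not ((a == y) ∨ any (y ==_) F) ∧ (avoids ys F ∧ notIn a ys)
      ≡⟨ shuffle (a == y) (any (y ==_) F) (avoids ys F) (any (a ==_) ys) ⟩
    (notIn y F ∧ avoids ys F) ∧ notIn a (y ∷ ys) ∎
    where
    open ≡-Reasoning
    shuffle : ∀ u v w z → not (u ∨ v) ∧ (w ∧ not z) ≡ (not v ∧ w) ∧ not (u ∨ z)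
    shuffle true  v w z = sym (𝔹.∧-zeroʳ (not v ∧ w))
    shuffle false v w z = sym (𝔹.∧-assoc (not v) w (not z))

  simpleAvoiding-∷ : ∀ F a ys → simpleAvoiding F (a ∷ ys) ≡ notIn a F ∧ simpleAvoiding (a ∷ F) ys
  simpleAvoiding-∷ F a ys = begin
    (notIn a F ∧ avoids ys F) ∧ (notIn a ys ∧ distinct ys)
      ≡⟨ 𝔹.∧-assoc (notIn a F) _ _ ⟩
    notIn a F ∧ (avoids ys F ∧ (notIn a ys ∧ distinct ys))
      ≡⟨ cong (notIn a F ∧_) (sym (𝔹.∧-assoc (avoids ys F) _ _)) ⟩
    notIn a F ∧ ((avoids ys F ∧ notIn a ys) ∧ distinct ys)
      ≡⟨ cong (λ b → notIn a F ∧ (b ∧ distinct ys)) (sym (avoids-∷ ys a F)) ⟩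
    notIn a F ∧ simpleAvoiding (a ∷ F) ys ∎
    where open ≡-Reasoning

  ∑-seqs-suc : ∀ k (f : List (Fin n) → ℚ) →
               ∑ (seqs (suc k)) f ≡ ∑ (allFin n) (λ b → ∑ (seqs k) (λ xs → f (b ∷ xs)))
  ∑-seqs-suc k f = trans (∑-concatMap (allFin n) _ f) (∑-cong (allFin n) (λ b → ∑-map (seqs k) (b ∷_) f))

  outcomes-𝔼 : ∀ es (f : Graph → ℚ) → ∑ (outcomes es) (λ w → proj₂ w * f (proj₁ w)) ≡ 𝔼 es f
  outcomes-𝔼 []             f = trans (+-identityʳ (1ℚ * f [])) (*-identityˡ (f []))
  outcomes-𝔼 ((i , j) ∷ es) f = begin
    ∑ (outcomes ((i , j) ∷ es)) (λ w → proj₂ w * f (proj₁ w))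
      ≡⟨ ∑-concatMap (outcomes es) _ _ ⟩
    ∑ (outcomes es) (λ w → p i j * proj₂ w * f ((i , j) ∷ proj₁ w) + ((1ℚ - p i j) * proj₂ w * f (proj₁ w) + 0ℚ))
      ≡⟨ ∑-cong (outcomes es) (λ w → factor (p i j) (proj₂ w) (f ((i , j) ∷ proj₁ w)) (f (proj₁ w))) ⟩
    ∑ (outcomes es) (λ w → proj₂ w * (p i j * f ((i , j) ∷ proj₁ w) + (1ℚ - p i j) * f (proj₁ w)))
      ≡⟨ outcomes-𝔼 es _ ⟩
    𝔼 ((i , j) ∷ es) f ∎
    where
    open ≡-Reasoning
    factor : ∀ π w a b → π * w * a + ((1ℚ - π) * w * b + 0ℚ) ≡ w * (π * a + (1ℚ - π) * b)
    factor = solve-∀ ℚ-ring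

  ∑-avoiding-≥ : ∀ (g : Fin n → ℚ) {M} → (∀ b → 0ℚ ≤ g b) → (∀ b → g b ≤ M) → ∀ F →
                 ∑ (allFin n) g - ℕ→ℚ (length F) * M ≤ ∑ (allFin n) (λ b → [ notIn b F ] * g b)
  ∑-avoiding-≥ g {M} 0≤g g≤M [] = ≤-reflexive (trans (no-loss (∑ (allFin n) g) M)
                                                    (∑-cong (allFin n) (λ b → sym (*-identityˡ (g b)))))
    where
    no-loss : ∀ s M → s - 0ℚ * M ≡ s
    no-loss = solve-∀ ℚ-ring
  ∑-avoiding-≥ g {M} 0≤g g≤M (x ∷ F) = begin
    ∑ (allFin n) g - ℕ→ℚ (suc (length F)) * M
      ≡⟨ cong (λ c → ∑ (allFin n) g - c * M) (ℕ→ℚ-+ 1 (length F)) ⟩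
    ∑ (allFin n) g - (1ℚ + ℕ→ℚ (length F)) * M
      ≡⟨ regroup (∑ (allFin n) g) (ℕ→ℚ (length F)) M ⟩
    ∑ (allFin n) g - ℕ→ℚ (length F) * M - M
      ≤⟨ p≤q+r⇒p-r≤q (begin
           ∑ (allFin n) g - ℕ→ℚ (length F) * M
             ≤⟨ ∑-avoiding-≥ g 0≤g g≤M F ⟩
           ∑ (allFin n) (λ b → [ notIn b F ] * g b)
             ≤⟨ ∑-mono (allFin n) (λ b → [not]-*-≤ (b == x) (any (b ==_) F) (0≤g b)) ⟩
           ∑ (allFin n) (λ b → [ notIn b (x ∷ F) ] * g b + [ b == x ] * g b)
             ≡⟨ trans (∑-+ (allFin n) _ _) (cong (∑ (allFin n) (λ b → [ notIn b (x ∷ F) ] * g b) +_) (∑-δ x g)) ⟩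
           ∑ (allFin n) (λ b → [ notIn b (x ∷ F) ] * g b) + g x
             ≤⟨ +-monoʳ-≤ (∑ (allFin n) (λ b → [ notIn b (x ∷ F) ] * g b)) (g≤M x) ⟩
           ∑ (allFin n) (λ b → [ notIn b (x ∷ F) ] * g b) + M ∎) ⟩
    ∑ (allFin n) (λ b → [ notIn b (x ∷ F) ] * g b) ∎
    where
    open ≤-Reasoning
    regroup : ∀ s c M → s - (1ℚ + c) * M ≡ s - c * M - M
    regroup = solve-∀ ℚ-ring

  module _ (t : Fin n) where

    walkWeight : List (Fin n) → ℚ
    walkWeight xs = [ endsAt t xs ] * edgeWeight (steps xs)

    -- The expected number of simple paths a = x₀, …, x_k = t avoiding the vertices of F.
    pathWeight : ℕ → Fin n → List (Fin n) → ℚ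
    pathWeight k a F = ∑ (seqs k) (λ xs → [ simpleAvoiding F (a ∷ xs) ] * walkWeight (a ∷ xs))

    𝔼-walkTo : ∀ xs → distinct xs ≡ true → 𝔼 Edges (λ G → [ walkTo G t xs ]) ≡ walkWeight xs
    𝔼-walkTo xs dxs = begin
      𝔼 Edges (λ G → [ walkTo G t xs ])
        ≡⟨ 𝔼-cong Edges (λ G → trans (cong [_] (trans (walkTo-≡ G t xs)
                                                      (𝔹.∧-comm (allAdjacent G (steps xs)) (endsAt t xs))))
                                   ([∧] (endsAt t xs) (allAdjacent G (steps xs)))) ⟩
      𝔼 Edges (λ G → [ endsAt t xs ] * [ allAdjacent G (steps xs) ])
        ≡⟨ 𝔼-*ˡ Edges [ endsAt t xs ] _ ⟩
      [ endsAt t xs ] * 𝔼 Edges (λ G → [ allAdjacent G (steps xs) ])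
        ≡⟨ cong ([ endsAt t xs ] *_) (𝔼-allAdjacent Edges (steps xs) (steps-uniquelyCovered xs dxs) (steps-sparse xs dxs)) ⟩
      walkWeight xs ∎
      where open ≡-Reasoning

    𝔼-isSimplePath : ∀ s x xs → 𝔼 Edges (λ G → [ isSimplePath G s t (x ∷ xs) ]) ≡
                                [ x == s ] * ([ distinct (x ∷ xs) ] * walkWeight (x ∷ xs))
    𝔼-isSimplePath s x xs = begin
      𝔼 Edges (λ G → [ isSimplePath G s t (x ∷ xs) ])
        ≡⟨ 𝔼-cong Edges (λ G → trans ([∧] (x == s) _) (cong ([ x == s ] *_) ([∧] (distinct (x ∷ xs)) _))) ⟩
      𝔼 Edges (λ G → [ x == s ] * ([ distinct (x ∷ xs) ] * [ walkTo G t (x ∷ xs) ]))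
        ≡⟨ 𝔼-*ˡ Edges [ x == s ] _ ⟩
      [ x == s ] * 𝔼 Edges (λ G → [ distinct (x ∷ xs) ] * [ walkTo G t (x ∷ xs) ])
        ≡⟨ cong ([ x == s ] *_) (trans (𝔼-*ˡ Edges [ distinct (x ∷ xs) ] _)
                                       ([]-*-cong (distinct (x ∷ xs)) (𝔼-walkTo (x ∷ xs)))) ⟩
      [ x == s ] * ([ distinct (x ∷ xs) ] * walkWeight (x ∷ xs)) ∎
      where open ≡-Reasoning

    ESP≡pathWeight : ∀ r s → ESP r s t ≡ pathWeight r s []
    ESP≡pathWeight r s = begin
      ESP r s t
        ≡⟨ outcomes-𝔼 Edges (λ G → ℕ→ℚ (SP G r s t)) ⟩
      𝔼 Edges (λ G → ℕ→ℚ (SP G r s t))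
        ≡⟨ 𝔼-cong Edges (λ G → ℕ→ℚ-count (isSimplePath G s t) (seqs (suc r))) ⟩
      𝔼 Edges (λ G → ∑ (seqs (suc r)) (λ xs → [ isSimplePath G s t xs ]))
        ≡⟨ 𝔼-∑ Edges (seqs (suc r)) _ ⟩
      ∑ (seqs (suc r)) (λ xs → 𝔼 Edges (λ G → [ isSimplePath G s t xs ]))
        ≡⟨ ∑-seqs-suc r _ ⟩
      ∑ (allFin n) (λ x → ∑ (seqs r) (λ xs → 𝔼 Edges (λ G → [ isSimplePath G s t (x ∷ xs) ])))
        ≡⟨ ∑-cong (allFin n) (λ x → trans (∑-cong (seqs r) (𝔼-isSimplePath s x)) (∑-*ˡ (seqs r) [ x == s ] _)) ⟩
      ∑ (allFin n) (λ x → [ x == s ] * ∑ (seqs r) (λ xs → [ distinct (x ∷ xs) ] * walkWeight (x ∷ xs)))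
        ≡⟨ ∑-δ s _ ⟩
      ∑ (seqs r) (λ xs → [ distinct (s ∷ xs) ] * walkWeight (s ∷ xs))
        ≡⟨ ∑-cong (seqs r) (λ xs → cong (λ b → [ b ∧ distinct (s ∷ xs) ] * walkWeight (s ∷ xs))
                                        (sym (avoids-[] (s ∷ xs)))) ⟩
      pathWeight r s [] ∎
      where open ≡-Reasoning

    pathWeight-zero : ∀ a F → pathWeight 0 a F ≡ [ notIn a F ] * [ a == t ]
    pathWeight-zero a F = trans (+-identityʳ _)
      (cong₂ _*_ (cong [_] (trans (𝔹.∧-identityʳ _) (𝔹.∧-identityʳ (notIn a F)))) (*-identityʳ [ a == t ]))

    pathWeight-suc : ∀ k a F →
                     pathWeight (suc k) a F ≡ [ notIn a F ] * ∑ (allFin n) (λ b → p a b * pathWeight k b (a ∷ F))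
    pathWeight-suc k a F = begin
      pathWeight (suc k) a F
        ≡⟨ ∑-seqs-suc k _ ⟩
      ∑ (allFin n) (λ b → ∑ (seqs k) (λ xs → [ simpleAvoiding F (a ∷ b ∷ xs) ] * walkWeight (a ∷ b ∷ xs)))
        ≡⟨ ∑-cong (allFin n) (λ b → trans (∑-cong (seqs k) (first-step b)) (∑-*ˡ (seqs k) ([ notIn a F ] * p a b) _)) ⟩
      ∑ (allFin n) (λ b → [ notIn a F ] * p a b * pathWeight k b (a ∷ F))
        ≡⟨ trans (∑-cong (allFin n) (λ b → *-assoc [ notIn a F ] (p a b) _)) (∑-*ˡ (allFin n) [ notIn a F ] _) ⟩
      [ notIn a F ] * ∑ (allFin n) (λ b → p a b * pathWeight k b (a ∷ F)) ∎
      where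
      open ≡-Reasoning
      rearrange : ∀ A B E P W → A * B * (E * (P * W)) ≡ A * P * (B * (E * W))
      rearrange = solve-∀ ℚ-ring
      first-step : ∀ b xs → [ simpleAvoiding F (a ∷ b ∷ xs) ] * walkWeight (a ∷ b ∷ xs) ≡
                            [ notIn a F ] * p a b * ([ simpleAvoiding (a ∷ F) (b ∷ xs) ] * walkWeight (b ∷ xs))
      first-step b xs = trans (cong (_* walkWeight (a ∷ b ∷ xs))
                                    (trans (cong [_] (simpleAvoiding-∷ F a (b ∷ xs))) ([∧] (notIn a F) _)))
                              (rearrange [ notIn a F ] [ simpleAvoiding (a ∷ F) (b ∷ xs) ] [ endsAt t (b ∷ xs) ]
                                         (p a b) (edgeWeight (steps (b ∷ xs))))

    pathWeight-one : ∀ a F → notIn a F ≡ true → notIn t (a ∷ F) ≡ true → pathWeight 1 a F ≡ p a t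
    pathWeight-one a F a∉F t∉aF = begin
      pathWeight 1 a F
        ≡⟨ pathWeight-suc 0 a F ⟩
      [ notIn a F ] * ∑ (allFin n) (λ b → p a b * pathWeight 0 b (a ∷ F))
        ≡⟨ cong₂ (λ β x → [ β ] * x) a∉F
                 (∑-cong (allFin n) (λ b → cong (p a b *_) (pathWeight-zero b (a ∷ F)))) ⟩
      1ℚ * ∑ (allFin n) (λ b → p a b * ([ notIn b (a ∷ F) ] * [ b == t ]))
        ≡⟨ trans (*-identityˡ _) (∑-cong (allFin n) (λ b → rotate (p a b) [ notIn b (a ∷ F) ] [ b == t ])) ⟩
      ∑ (allFin n) (λ b → [ b == t ] * (p a b * [ notIn b (a ∷ F) ]))
        ≡⟨ ∑-δ t _ ⟩
      p a t * [ notIn t (a ∷ F) ]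
        ≡⟨ trans (cong (λ β → p a t * [ β ]) t∉aF) (*-identityʳ (p a t)) ⟩
      p a t ∎
      where
      open ≡-Reasoning
      rotate : ∀ x y z → x * (y * z) ≡ z * (x * y)
      rotate = solve-∀ ℚ-ring

-- The lower bound

-- forbiddenTotal m f = Σ_{i<m} (f + 2 + i): in each of the last m steps of a path the next vertex
-- must avoid the target, the current vertex and the f + i vertices visited before it.
forbiddenTotal : ℕ → ℕ → ℕ
forbiddenTotal zero    f = 0
forbiddenTotal (suc m) f = forbiddenTotal m (suc f) ℕ.+ suc (suc f)

forbiddenTotal-double : ∀ m f → forbiddenTotal m f ℕ.+ forbiddenTotal m f ≡ m ℕ.* suc m ℕ.+ 2 ℕ.* m ℕ.* suc f
forbiddenTotal-double zero    f = refl
forbiddenTotal-double (suc m) f = begin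
  (A ℕ.+ k) ℕ.+ (A ℕ.+ k)                                 ≡⟨ interchange A k ⟩
  (A ℕ.+ A) ℕ.+ (k ℕ.+ k)                                 ≡⟨ cong (ℕ._+ (k ℕ.+ k)) (forbiddenTotal-double m (suc f)) ⟩
  m ℕ.* suc m ℕ.+ 2 ℕ.* m ℕ.* suc (suc f) ℕ.+ (k ℕ.+ k)   ≡⟨ closed-form m f ⟩
  suc m ℕ.* suc (suc m) ℕ.+ 2 ℕ.* suc m ℕ.* suc f         ∎
  where
  open ≡-Reasoning
  A : ℕ
  A = forbiddenTotal m (suc f)
  k : ℕ
  k = suc (suc f)
  interchange : ∀ a b → (a ℕ.+ b) ℕ.+ (a ℕ.+ b) ≡ (a ℕ.+ a) ℕ.+ (b ℕ.+ b)
  interchange = ℕ-Solver.solve-∀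
  closed-form : ∀ m f → m ℕ.* (1 ℕ.+ m) ℕ.+ 2 ℕ.* m ℕ.* (2 ℕ.+ f) ℕ.+ ((2 ℕ.+ f) ℕ.+ (2 ℕ.+ f))
                        ≡ (1 ℕ.+ m) ℕ.* (2 ℕ.+ m) ℕ.+ 2 ℕ.* (1 ℕ.+ m) ℕ.* (1 ℕ.+ f)
  closed-form = ℕ-Solver.solve-∀

pronic-forbiddenTotal : ∀ m → suc m ℕ.* (suc m ℕ.+ 1) ≡ suc (forbiddenTotal m 0) ℕ.+ suc (forbiddenTotal m 0)
pronic-forbiddenTotal m = begin
  suc m ℕ.* (suc m ℕ.+ 1)                                 ≡⟨ expand m ⟩
  m ℕ.* suc m ℕ.+ 2 ℕ.* m ℕ.* 1 ℕ.+ 2                     ≡⟨ cong (ℕ._+ 2) (forbiddenTotal-double m 0) ⟨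
  forbiddenTotal m 0 ℕ.+ forbiddenTotal m 0 ℕ.+ 2         ≡⟨ shift (forbiddenTotal m 0) ⟩
  suc (forbiddenTotal m 0) ℕ.+ suc (forbiddenTotal m 0)   ∎
  where
  open ≡-Reasoning
  expand : ∀ m → (1 ℕ.+ m) ℕ.* ((1 ℕ.+ m) ℕ.+ 1) ≡ m ℕ.* (1 ℕ.+ m) ℕ.+ 2 ℕ.* m ℕ.* 1 ℕ.+ 2
  expand = ℕ-Solver.solve-∀
  shift : ∀ x → x ℕ.+ x ℕ.+ 2 ≡ (1 ℕ.+ x) ℕ.+ (1 ℕ.+ x)
  shift = ℕ-Solver.solve-∀

module LowerBound {n : ℕ} (d : Fin n → ℚ) (d≥0 : ∀ i → 0ℚ ≤ d i) (S>0 : 0ℚ < ChungLu.S d) where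
  open ChungLu d
  open SimplePaths d

  S≢0 : S ≢ 0ℚ
  S≢0 S≡0 = <⇒≢ S>0 (sym S≡0)

  σ : ℚ
  σ = (1/ S) {{≢-nonZero S≢0}}

  σ≥0 : 0ℚ ≤ σ
  σ≥0 = <⇒≤ (positive⁻¹ σ {{1/pos⇒pos S {{positive S>0}}}})

  p≡ : ∀ a b → p a b ≡ d a * d b * σ
  p≡ a b = ÷'-≡ (d a * d b) S≢0

  p≥0 : ∀ a b → 0ℚ ≤ p a b
  p≥0 a b = subst (0ℚ ≤_) (sym (p≡ a b)) (*-nonNeg (*-nonNeg (d≥0 a) (d≥0 b)) σ≥0)

  p-∘-p : ∀ a b c → p a b * p b c ≡ p a c * (σ * (d b * d b))
  p-∘-p a b c = begin
    p a b * p b c                        ≡⟨ cong₂ _*_ (p≡ a b) (p≡ b c) ⟩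
    d a * d b * σ * (d b * d c * σ)      ≡⟨ regroup (d a) (d b) (d c) σ ⟩
    d a * d c * σ * (σ * (d b * d b))    ≡⟨ cong (_* (σ * (d b * d b))) (p≡ a c) ⟨
    p a c * (σ * (d b * d b))            ∎
    where
    open ≡-Reasoning
    regroup : ∀ x y z s → x * y * s * (y * z * s) ≡ x * z * s * (s * (y * y))
    regroup = solve-∀ ℚ-ring

  sq≥0 : ∀ b → 0ℚ ≤ d b * d b
  sq≥0 b = *-nonNeg (d≥0 b) (d≥0 b)

  S₂≥0 : 0ℚ ≤ S₂
  S₂≥0 = ∑-nonNeg (allFin n) sq≥0

  S₂>0 : 0ℚ < S₂
  S₂>0 with ∑-positive⇒∃ (allFin n) S>0
  ... | i , 0<di = <-≤-trans (positive⁻¹ (d i * d i) {{pos*pos⇒pos (d i) {{positive 0<di}} (d i) {{positive 0<di}}}})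
                             (∈⇒≤∑ sq≥0 (∈-allFin i))

  S₂≢0 : S₂ ≢ 0ℚ
  S₂≢0 S₂≡0 = <⇒≢ S₂>0 (sym S₂≡0)

  ρ : ℚ
  ρ = S₂ ÷' S

  ρ≥0 : 0ℚ ≤ ρ
  ρ≥0 = subst (0ℚ ≤_) (sym (÷'-≡ S₂ S≢0)) (*-nonNeg S₂≥0 σ≥0)

  M : ℚ
  M = dmax * dmax

  dmax≥0 : 0ℚ ≤ dmax
  dmax≥0 = foldr-⊔-≥ 0ℚ (map d (allFin n))

  M≥0 : 0ℚ ≤ M
  M≥0 = *-nonNeg dmax≥0 dmax≥0

  sq≤M : ∀ b → d b * d b ≤ M
  sq≤M b = ≤-trans (*-monoˡ-≤-0≤ (d≥0 b) db≤dmax) (*-monoʳ-≤-nonNeg dmax {{nonNegative dmax≥0}} db≤dmax)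
    where
    db≤dmax : d b ≤ dmax
    db≤dmax = ≤-foldr-⊔ 0ℚ (∈-map⁺ d (∈-allFin b))

  pathWeight-nonNeg : ∀ t k a F → 0ℚ ≤ pathWeight t k a F
  pathWeight-nonNeg t k a F = ∑-nonNeg (seqs k) (λ xs →
    *-nonNeg ([]-nonNeg (simpleAvoiding F (a ∷ xs)))
             (*-nonNeg ([]-nonNeg (endsAt t (a ∷ xs))) (∏-nonNeg (steps (a ∷ xs)) (λ r → p≥0 (proj₁ r) (proj₂ r)))))

  S₂-pathWeight-suc : ∀ t k a F → notIn a F ≡ true →
                      S₂ * pathWeight t (suc k) a F ≡ ∑ (allFin n) (λ b → p a b * (S₂ * pathWeight t k b (a ∷ F)))
  S₂-pathWeight-suc t k a F a∉F = begin
    S₂ * pathWeight t (suc k) a F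
      ≡⟨ cong (S₂ *_) (pathWeight-suc t k a F) ⟩
    S₂ * ([ notIn a F ] * ∑ (allFin n) (λ b → p a b * pathWeight t k b (a ∷ F)))
      ≡⟨ cong (λ β → S₂ * ([ β ] * ∑ (allFin n) (λ b → p a b * pathWeight t k b (a ∷ F)))) a∉F ⟩
    S₂ * (1ℚ * ∑ (allFin n) (λ b → p a b * pathWeight t k b (a ∷ F)))
      ≡⟨ cong (S₂ *_) (*-identityˡ _) ⟩
    S₂ * ∑ (allFin n) (λ b → p a b * pathWeight t k b (a ∷ F))
      ≡⟨ ∑-*ˡ (allFin n) S₂ _ ⟨
    ∑ (allFin n) (λ b → S₂ * (p a b * pathWeight t k b (a ∷ F)))
      ≡⟨ ∑-cong (allFin n) (λ b → swap S₂ (p a b) (pathWeight t k b (a ∷ F))) ⟩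
    ∑ (allFin n) (λ b → p a b * (S₂ * pathWeight t k b (a ∷ F))) ∎
    where
    open ≡-Reasoning
    swap : ∀ x y z → x * (y * z) ≡ y * (x * z)
    swap = solve-∀ ℚ-ring

  ∑-two-steps : ∀ a t L R Z → ∑ (allFin n) (λ b → p a b * ([ notIn b L ] * (p b t * R * Z)))
                              ≡ p a t * R * σ * (Z * ∑ (allFin n) (λ b → [ notIn b L ] * (d b * d b)))
  ∑-two-steps a t L R Z = begin
    ∑ (allFin n) (λ b → p a b * ([ notIn b L ] * (p b t * R * Z)))
      ≡⟨ ∑-cong (allFin n) two-steps ⟩
    ∑ (allFin n) (λ b → p a t * R * σ * (Z * ([ notIn b L ] * (d b * d b))))
      ≡⟨ trans (∑-*ˡ (allFin n) (p a t * R * σ) _) (cong (p a t * R * σ *_) (∑-*ˡ (allFin n) Z _)) ⟩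
    p a t * R * σ * (Z * ∑ (allFin n) (λ b → [ notIn b L ] * (d b * d b))) ∎
    where
    open ≡-Reasoning
    pair-up : ∀ x β y R Z → x * (β * (y * R * Z)) ≡ x * y * (β * R * Z)
    pair-up = solve-∀ ℚ-ring
    spread : ∀ P s q β R Z → P * (s * q) * (β * R * Z) ≡ P * R * s * (Z * (β * q))
    spread = solve-∀ ℚ-ring
    two-steps : ∀ b → p a b * ([ notIn b L ] * (p b t * R * Z)) ≡ p a t * R * σ * (Z * ([ notIn b L ] * (d b * d b)))
    two-steps b = begin
      p a b * ([ notIn b L ] * (p b t * R * Z))             ≡⟨ pair-up (p a b) [ notIn b L ] (p b t) R Z ⟩
      p a b * p b t * ([ notIn b L ] * R * Z)               ≡⟨ cong (_* ([ notIn b L ] * R * Z)) (p-∘-p a b t) ⟩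
      p a t * (σ * (d b * d b)) * ([ notIn b L ] * R * Z)   ≡⟨ spread (p a t) σ (d b * d b) [ notIn b L ] R Z ⟩
      p a t * R * σ * (Z * ([ notIn b L ] * (d b * d b)))   ∎

  pathWeight-lowerBound : ∀ t m a F → notIn a F ≡ true → notIn t F ≡ true → a ≢ t →
    p a t * ρ ^' m * (S₂ - ℕ→ℚ (forbiddenTotal m (length F)) * M) ≤ S₂ * pathWeight t (suc m) a F
  pathWeight-lowerBound t zero a F a∉F t∉F a≢t = ≤-reflexive (begin
    p a t * 1ℚ * (S₂ - 0ℚ * M)   ≡⟨ collapse (p a t) S₂ M ⟩
    S₂ * p a t                   ≡⟨ cong (S₂ *_) (pathWeight-one t a F a∉F t∉aF) ⟨
    S₂ * pathWeight t 1 a F      ∎)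
    where
    open ≡-Reasoning
    collapse : ∀ x s M → x * 1ℚ * (s - 0ℚ * M) ≡ s * x
    collapse = solve-∀ ℚ-ring
    t∉aF : notIn t (a ∷ F) ≡ true
    t∉aF = notIn-∷⁺ {t} {a} {F} (a≢t ∘ sym) t∉F
  pathWeight-lowerBound t (suc m) a F a∉F t∉F a≢t = begin
    p a t * ρ ^' suc m * (S₂ - ℕ→ℚ (forbiddenTotal (suc m) (length F)) * M)
      ≡⟨ cong₂ (λ r x → p a t * (r * ρ ^' m) * (S₂ - x * M)) (÷'-≡ S₂ S≢0)
               (ℕ→ℚ-+ (forbiddenTotal m (suc (length F))) (length L)) ⟩
    p a t * (S₂ * σ * ρ ^' m) * (S₂ - (c + f) * M)
      ≡⟨ regroup (p a t) (ρ ^' m) S₂ σ c f M ⟩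
    κ * (S₂ * (S₂ - c * M - f * M))
      ≤⟨ *-monoˡ-≤-0≤ κ≥0 (deficit-product-≤ S₂≥0 (*-nonNeg c≥0 M≥0) (*-nonNeg f≥0 M≥0)
                                              (∑-avoiding-≥ (λ b → d b * d b) sq≥0 sq≤M L)
                                              (∑-mono (allFin n) (λ b → []-*-≤ (notIn b L) (sq≥0 b)))) ⟩
    κ * ((S₂ - c * M) * G)
      ≡⟨ ∑-two-steps a t L (ρ ^' m) (S₂ - c * M) ⟨
    ∑ (allFin n) (λ b → p a b * ([ notIn b L ] * (p b t * ρ ^' m * (S₂ - c * M))))
      ≤⟨ ∑-mono (allFin n) (λ b → *-monoˡ-≤-0≤ (p≥0 a b) (extend b)) ⟩
    ∑ (allFin n) (λ b → p a b * (S₂ * pathWeight t (suc m) b (a ∷ F)))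
      ≡⟨ S₂-pathWeight-suc t (suc m) a F a∉F ⟨
    S₂ * pathWeight t (suc (suc m)) a F ∎
    where
    open ≤-Reasoning
    L : List (Fin n)
    L = t ∷ a ∷ F
    c : ℚ
    c = ℕ→ℚ (forbiddenTotal m (suc (length F)))
    f : ℚ
    f = ℕ→ℚ (length L)
    κ : ℚ
    κ = p a t * ρ ^' m * σ
    G : ℚ
    G = ∑ (allFin n) (λ b → [ notIn b L ] * (d b * d b))
    c≥0 : 0ℚ ≤ c
    c≥0 = ℕ→ℚ-nonNeg (forbiddenTotal m (suc (length F)))
    f≥0 : 0ℚ ≤ f
    f≥0 = ℕ→ℚ-nonNeg (length L)
    κ≥0 : 0ℚ ≤ κ
    κ≥0 = *-nonNeg (*-nonNeg (p≥0 a t) (^'-nonNeg m ρ≥0)) σ≥0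
    regroup : ∀ P R s σ c f M → P * (s * σ * R) * (s - (c + f) * M) ≡ P * R * σ * (s * (s - c * M - f * M))
    regroup = solve-∀ ℚ-ring
    t∉aF : notIn t (a ∷ F) ≡ true
    t∉aF = notIn-∷⁺ {t} {a} {F} (a≢t ∘ sym) t∉F
    extend : ∀ b → [ notIn b L ] * (p b t * ρ ^' m * (S₂ - c * M)) ≤ S₂ * pathWeight t (suc m) b (a ∷ F)
    extend b with notIn b L in b∉L
    ... | true  = subst (_≤ S₂ * pathWeight t (suc m) b (a ∷ F)) (sym (*-identityˡ (p b t * ρ ^' m * (S₂ - c * M))))
                        (pathWeight-lowerBound t m b (a ∷ F) (proj₂ (notIn-∷ b t (a ∷ F) b∉L)) t∉aF
                                                             (proj₁ (notIn-∷ b t (a ∷ F) b∉L)))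
    ... | false = subst (_≤ S₂ * pathWeight t (suc m) b (a ∷ F)) (sym (*-zeroˡ (p b t * ρ ^' m * (S₂ - c * M))))
                        (*-nonNeg S₂≥0 (pathWeight-nonNeg t (suc m) b (a ∷ F)))

  scaled-bound-≤ : ∀ s t m →
    S₂ * ((p s t * (ρ ^' m)) * (1ℚ - ((ℕ→ℚ (suc m ℕ.* (suc m ℕ.+ 1)) * pmax) ÷' ℕ→ℚ 2) * (S ÷' S₂)))
      ≤ p s t * ρ ^' m * (S₂ - ℕ→ℚ (forbiddenTotal m 0) * M)
  scaled-bound-≤ s t m = begin
    S₂ * (P * (1ℚ - ((ℕ→ℚ (suc m ℕ.* (suc m ℕ.+ 1)) * pmax) ÷' ℕ→ℚ 2) * (S ÷' S₂)))
      ≡⟨ cong (λ x → S₂ * (P * (1ℚ - x * (S ÷' S₂)))) half-pronic ⟩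
    S₂ * (P * (1ℚ - y * pmax * (S ÷' S₂)))
      ≡⟨ cong (λ x → S₂ * (P * (1ℚ - x))) (trans (*-assoc y pmax (S ÷' S₂))
                                                  (cong (y *_) (÷'-*-÷' M S≢0 S₂≢0))) ⟩
    S₂ * (P * (1ℚ - y * (M ÷' S₂)))
      ≡⟨ distribute S₂ P y (M ÷' S₂) ⟩
    P * (S₂ - y * (S₂ * (M ÷' S₂)))
      ≡⟨ cong (λ x → P * (S₂ - y * x)) (*-÷'-cancel M S₂≢0) ⟩
    P * (S₂ - y * M)
      ≤⟨ *-monoˡ-≤-0≤ P≥0 (≤-trans (p≤p+q M≥0) (≤-reflexive (one-less S₂ c M))) ⟩
    P * (S₂ - c * M) ∎
    where
    open ≤-Reasoning
    P : ℚ
    P = p s t * ρ ^' m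
    c : ℚ
    c = ℕ→ℚ (forbiddenTotal m 0)
    y : ℚ
    y = 1ℚ + c
    P≥0 : 0ℚ ≤ P
    P≥0 = *-nonNeg (p≥0 s t) (^'-nonNeg m ρ≥0)
    double : ∀ y x → (y + y) * x ≡ (1ℚ + 1ℚ) * (y * x)
    double = solve-∀ ℚ-ring
    distribute : ∀ s P y q → s * (P * (1ℚ - y * q)) ≡ P * (s - y * (s * q))
    distribute = solve-∀ ℚ-ring
    one-less : ∀ s c M → s - (1ℚ + c) * M + M ≡ s - c * M
    one-less = solve-∀ ℚ-ring
    ℕ→ℚ-pronic : ℕ→ℚ (suc m ℕ.* (suc m ℕ.+ 1)) ≡ y + y
    ℕ→ℚ-pronic = trans (cong ℕ→ℚ (pronic-forbiddenTotal m))
                       (trans (ℕ→ℚ-+ (suc (forbiddenTotal m 0)) (suc (forbiddenTotal m 0)))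
                              (cong₂ _+_ (ℕ→ℚ-+ 1 (forbiddenTotal m 0)) (ℕ→ℚ-+ 1 (forbiddenTotal m 0))))
    half-pronic : (ℕ→ℚ (suc m ℕ.* (suc m ℕ.+ 1)) * pmax) ÷' ℕ→ℚ 2 ≡ y * pmax
    half-pronic = trans (cong (λ x → (x * pmax) ÷' ℕ→ℚ 2) ℕ→ℚ-pronic)
                        (trans (cong (_÷' ℕ→ℚ 2) (double y pmax)) (*-÷'-cancelˡ (y * pmax) {ℕ→ℚ 2} (λ ())))

lemma2 : (n : ℕ) (d : Fin n → ℚ)
           → (∀ i → 0ℚ ≤ d i)
           → 0ℚ < ChungLu.S d
           → (∀ i → d i * d i ≤ ChungLu.S d)
           → (s t : Fin n) → s ≢ t → (r : ℕ) → r ≥ 1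
           → (ChungLu.p d s t * ((ChungLu.S₂ d ÷' ChungLu.S d) ^' (r Data.Nat.∸ 1)))
               * (1ℚ - ((ℕ→ℚ (r Data.Nat.* (r Data.Nat.+ 1)) * ChungLu.pmax d) ÷' ℕ→ℚ 2) * (ChungLu.S d ÷' ChungLu.S₂ d))
             ≤ ChungLu.ESP d r s t
lemma2 n d d≥0 S>0 _ s t s≢t zero    ()
lemma2 n d d≥0 S>0 _ s t s≢t (suc m) _ = *-cancelˡ-≤-pos S₂ {{positive S₂>0}} (begin
  S₂ * _                                                  ≤⟨ scaled-bound-≤ s t m ⟩
  p s t * ρ ^' m * (S₂ - ℕ→ℚ (forbiddenTotal m 0) * M)    ≤⟨ pathWeight-lowerBound t m s [] refl refl s≢t ⟩
  S₂ * pathWeight t (suc m) s []                          ≡⟨ cong (S₂ *_) (ESP≡pathWeight t (suc m) s) ⟨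
  S₂ * ESP (suc m) s t                                    ∎)
  where
  open ChungLu d
  open SimplePaths d
  open LowerBound d d≥0 S>0
  open ≤-Reasoning
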